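{- Let $G$ be a connected graph and $X\subseteq V(G)$. The following are equivalent: (i) $X$ is a total mutual-visibility set of $G$; (ii) any two vertices $u,v$ of $G$ with $d_G(u,v)=2$ are $X$-visible; (iii) any two vertices $u,v$ of $G$ with $d_G(u,v)=2$ satisfy $N_G(u)\cap N_G(v)\not\subseteq X$.
   Context: For $X\subseteq V(G)$, two vertices $x,y$ are $X$-visible if there is a shortest $x,y$-path in $G$ with no internal vertex in $X$; $X$ is a total mutual-visibility set if any two vertices of $V(G)$ are $X$-visible. $N_G(v)$ is the set of neighbours of $v$ and $d_G$ the shortest-path distance. -}

module Defs where

open import Data.Nat using (ℕ; zero; suc; _≤_)
open import Data.Fin using (Fin)
open import Data.Fin.Subset using (Subset; _∈_; _∉_)
open import Data.List using (List; []; _∷_)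
open import Data.List.Relation.Unary.All using (All)
open import Data.Product using (Σ; ∃; _×_; _,_)
open import Relation.Nullary using (¬_)
open import Relation.Binary.Definitions using (Decidable)

record Graph : Set₁ where
  field
    n      : ℕ
    Adj    : Fin n → Fin n → Set
    adj?   : Decidable Adj
    symm   : ∀ {x y} → Adj x y → Adj y x
    irrefl : ∀ {x} → ¬ Adj x x

module _ (G : Graph) where
  open Graph G

  Vertex : Set
  Vertex = Fin n

  data Walk : Vertex → Vertex → ℕ → Set where
    nil  : ∀ {x} → Walk x x zero
    cons : ∀ {x y z k} → Adj x y → Walk y z k → Walk x z (suc k)

  initVerts : ∀ {x y k} → Walk x y k → List Vertex
  initVerts nil = []
  initVerts (cons {x = x} e w) = x ∷ initVerts w

  internal : ∀ {x y k} → Walk x y k → List Vertex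
  internal nil = []
  internal (cons e w) = initVerts w

  Connected : Set
  Connected = ∀ x y → ∃ λ k → Walk x y k

  Dist : Vertex → Vertex → ℕ → Set
  Dist x y k = Walk x y k × (∀ m → Walk x y m → k ≤ m)

  Visible : Subset n → Vertex → Vertex → Set
  Visible X x y = Σ ℕ λ k → Dist x y k ×
                    Σ (Walk x y k) λ w → All (λ v → v ∉ X) (internal w)

  TotalMutualVisibility : Subset n → Set
  TotalMutualVisibility X = ∀ x y → Visible X x y

  N : Vertex → Vertex → Set
  N v w = Adj v w

  CommonNbhdSubset : Vertex → Vertex → Subset n → Set
  CommonNbhdSubset u v X = ∀ w → N u w → N v w → w ∈ X

-- (i) ⇒ (ii) is trivial, and for d(u,v) = 2 a visible shortest
-- path u w v says precisely that the common neighbour w lies outside X,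
-- giving (ii) ⇒ (iii).  For (iii) ⇒ (i), take a shortest path x a b … y of
-- length ≥ 2.  Then d(x,b) = 2, so x and b have a common neighbour z ∉ X;
-- x z b … y is again shortest, and by induction on the distance the
-- shortest z,y-path may be chosen with no internal vertex in X.

module Submission where

open import Defs
open import Data.Fin.Subset using (Subset)
open import Data.Product using (_×_)
open import Relation.Nullary using (¬_)
open import Function.Bundles using (_⇔_)

open import Data.Empty using (⊥-elim)
open import Data.Fin using (_≟_)
open import Data.Fin.Properties using (any?)
open import Data.Fin.Subset using (_∉_)
open import Data.Fin.Subset.Properties using (_∈?_)
open import Data.List.Relation.Unary.All using (All; []; _∷_)
open import Data.Nat using (ℕ; zero; suc; _+_; _≤_; _<_)
open import Data.Nat.Properties
  using (≤-refl; ≤-antisym; ≮⇒≥; m<1+n⇒m<n∨m≡n; +-cancelˡ-≤; +-cancelʳ-≤)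
open import Data.Product using (Σ; ∃; _,_; proj₂)
open import Data.Sum using (_⊎_; inj₁; inj₂)
open import Function.Bundles using (mk⇔)
open import Relation.Binary.PropositionalEquality using (_≡_; refl)
open import Relation.Nullary using (Dec; yes; no; ¬?)
open import Relation.Nullary.Decidable using (_×-dec_; decidable-stable)
import Relation.Unary as U

module _ {p} {P : ℕ → Set p} (P? : U.Decidable P) where

  least-below-or-none : ∀ K → (∃ λ k → P k × ∀ m → m < k → ¬ P m)
                            ⊎ (∀ m → m < K → ¬ P m)
  least-below-or-none zero = inj₂ λ _ ()
  least-below-or-none (suc K) with least-below-or-none K
  ... | inj₁ least = inj₁ least
  ... | inj₂ none with P? K
  ...   | yes pK = inj₁ (K , pK , none)
  ...   | no ¬pK = inj₂ λ m m<1+K → none-≤K m (m<1+n⇒m<n∨m≡n m<1+K)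
    where
    none-≤K : ∀ m → m < K ⊎ m ≡ K → ¬ P m
    none-≤K m (inj₁ m<K) = none m m<K
    none-≤K m (inj₂ refl) = ¬pK

  least-witness : ∀ {K} → P K → ∃ λ k → P k × ∀ m → P m → k ≤ m
  least-witness {K} pK with least-below-or-none (suc K)
  ... | inj₁ (k , pk , below) = k , pk , λ m pm → ≮⇒≥ λ m<k → below m m<k pm
  ... | inj₂ none = ⊥-elim (none K ≤-refl pK)

module _ (G : Graph) where
  open Graph G

  _++ʷ_ : ∀ {x y z m k} → Walk G x y m → Walk G y z k → Walk G x z (m + k)
  nil ++ʷ q = q
  cons e p ++ʷ q = cons e (p ++ʷ q)

  walk? : ∀ k x y → Dec (Walk G x y k)
  walk? zero x y with x ≟ y
  ... | yes refl = yes nil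
  ... | no x≢y = no λ { nil → x≢y refl }
  walk? (suc k) x y with any? (λ z → adj? x z ×-dec walk? k z y)
  ... | yes (z , e , w) = yes (cons e w)
  ... | no none = no λ { (cons e w) → none (_ , e , w) }

  walk⇒dist : ∀ {x y K} → Walk G x y K → ∃ (Dist G x y)
  walk⇒dist = least-witness (λ k → walk? k _ _)

  dist-unique : ∀ {x y k l} → Dist G x y k → Dist G x y l → k ≡ l
  dist-unique (p , p-min) (q , q-min) = ≤-antisym (p-min _ q) (q-min _ p)

  dist-prefix : ∀ {x b y m k} → Dist G x y (m + k) →
                Walk G x b m → Walk G b y k → Dist G x b m
  dist-prefix {k = k} (_ , min) p q =
    p , λ m′ p′ → +-cancelʳ-≤ k _ m′ (min (m′ + k) (p′ ++ʷ q))

  dist-suffix : ∀ {x b y m k} → Dist G x y (m + k) →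
                Walk G x b m → Walk G b y k → Dist G b y k
  dist-suffix {m = m} (_ , min) p q =
    q , λ k′ q′ → +-cancelˡ-≤ m _ k′ (min (m + k′) (p ++ʷ q′))

  ClearWalk : Subset n → Vertex G → Vertex G → ℕ → Set
  ClearWalk X x y k = Σ (Walk G x y k) λ w → All (_∉ X) (internal G w)

  cons-clear : ∀ {X x z y k} → Adj x z → z ∉ X →
               ClearWalk X z y (suc k) → ClearWalk X x y (suc (suc k))
  cons-clear xz z∉X (cons e w , clear) = cons xz (cons e w) , z∉X ∷ clear

  ¬⊆⇒∃∉ : ∀ {u v X} → ¬ CommonNbhdSubset G u v X →
          ∃ λ z → Adj u z × Adj v z × z ∉ X
  ¬⊆⇒∃∉ {u} {v} {X} ¬⊆ with any? (λ z → adj? u z ×-dec adj? v z ×-dec ¬? (z ∈? X))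
  ... | yes found = found
  ... | no none = ⊥-elim (¬⊆ λ z uz vz →
                    decidable-stable (z ∈? X) λ z∉X → none (z , uz , vz , z∉X))

  module _ (X : Subset n) where

    CommonNeighbourOutside : Set
    CommonNeighbourOutside = ∀ u v → Dist G u v 2 → ¬ CommonNbhdSubset G u v X

    dist⇒clear : CommonNeighbourOutside → ∀ k {x y} → Dist G x y k → ClearWalk X x y k
    dist⇒clear _ zero (nil , _) = nil , []
    dist⇒clear _ (suc zero) (cons e nil , _) = cons e nil , []
    dist⇒clear c (suc (suc k)) d@(cons xa (cons {y = b} ab w) , _) =
      let z , xz , bz , z∉X = ¬⊆⇒∃∉ (c _ b (dist-prefix d (cons xa (cons ab nil)) w))
      in cons-clear xz z∉X (dist⇒clear c (suc k) (dist-suffix d (cons xz nil) (cons (symm bz) w)))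

    visible⇒¬⊆ : ∀ {u v} → Dist G u v 2 → Visible G X u v → ¬ CommonNbhdSubset G u v X
    visible⇒¬⊆ d (_ , dk , _) with dist-unique dk d
    visible⇒¬⊆ d (_ , _ , cons uw (cons wv nil) , w∉X ∷ []) | refl =
      λ ⊆X → w∉X (⊆X _ uw (symm wv))

    clear⇒total : Connected G → CommonNeighbourOutside → TotalMutualVisibility G X
    clear⇒total conn c x y =
      let k , d = walk⇒dist (proj₂ (conn x y)) in k , d , dist⇒clear c k d

theorem5p2 : (G : Graph) → Connected G → (X : Subset (Graph.n G)) →
    (TotalMutualVisibility G X ⇔ (∀ u v → Dist G u v 2 → Visible G X u v))
    × (TotalMutualVisibility G X ⇔ (∀ u v → Dist G u v 2 → ¬ CommonNbhdSubset G u v X))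
theorem5p2 G conn X =
  mk⇔ i⇒ii (λ ii → iii⇒i (ii⇒iii ii)) , mk⇔ (λ i → ii⇒iii (i⇒ii i)) iii⇒i
  where
  i⇒ii : TotalMutualVisibility G X → ∀ u v → Dist G u v 2 → Visible G X u v
  i⇒ii total u v _ = total u v

  ii⇒iii : (∀ u v → Dist G u v 2 → Visible G X u v) → CommonNeighbourOutside G X
  ii⇒iii ii u v d = visible⇒¬⊆ G X d (ii u v d)

  iii⇒i : CommonNeighbourOutside G X → TotalMutualVisibility G X
  iii⇒i = clear⇒total G X conn
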